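{- Let $G$ be a $P_5$-free graph. If $(a,b,c,d)$ is an induced path $P_4$ in $G$ (with edges $ab,bc,cd$), then neither $b$ nor $c$ belongs to any efficient dominating set of $G$.
   Context: All graphs are finite, undirected and simple. A vertex dominates itself and all its neighbors. A vertex set $D$ of $G$ is an efficient dominating set if every vertex of $G$ is dominated by exactly one vertex of $D$. $P_k$ is the chordless path on $k$ vertices; $G$ is $P_5$-free if it has no induced $P_5$. -}

module Defs where

open import Data.Nat using (ℕ)
open import Data.Fin using (Fin)
open import Data.Product using (Σ; _×_; ∃)
open import Data.Sum using (_⊎_)
open import Relation.Nullary using (¬_; Dec)
open import Relation.Binary.PropositionalEquality using (_≡_)
open import Level using (0ℓ; suc)

record Graph (n : ℕ) : Set₁ where
  field
    Adj     : Fin n → Fin n → Set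
    sym     : ∀ {u v} → Adj u v → Adj v u
    irrefl  : ∀ {u} → ¬ Adj u u
    adj?    : ∀ u v → Dec (Adj u v)
open Graph public

Dominates : ∀ {n} → Graph n → Fin n → Fin n → Set
Dominates G u v = (u ≡ v) ⊎ Adj G u v

IsEfficientDominatingSet : ∀ {n} → Graph n → (Fin n → Set) → Set
IsEfficientDominatingSet {n} G D =
  ∀ (v : Fin n) →
    Σ (Fin n) (λ d → (D d × Dominates G d v) ×
      (∀ d' → D d' → Dominates G d' v → d' ≡ d))

IsInducedP4 : ∀ {n} → Graph n → Fin n → Fin n → Fin n → Fin n → Set
IsInducedP4 G a b c d =
  (¬ a ≡ b) × (¬ a ≡ c) × (¬ a ≡ d) × (¬ b ≡ c) × (¬ b ≡ d) × (¬ c ≡ d) ×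
  Adj G a b × Adj G b c × Adj G c d ×
  (¬ Adj G a c) × (¬ Adj G a d) × (¬ Adj G b d)

IsInducedP5 : ∀ {n} → Graph n → Fin n → Fin n → Fin n → Fin n → Fin n → Set
IsInducedP5 G a b c d e =
  ((¬ a ≡ b) × (¬ a ≡ c) × (¬ a ≡ d) × (¬ a ≡ e) ×
   (¬ b ≡ c) × (¬ b ≡ d) × (¬ b ≡ e) ×
   (¬ c ≡ d) × (¬ c ≡ e) × (¬ d ≡ e)) ×
  (Adj G a b × Adj G b c × Adj G c d × Adj G d e) ×
  ((¬ Adj G a c) × (¬ Adj G a d) × (¬ Adj G a e) ×
   (¬ Adj G b d) × (¬ Adj G b e) × (¬ Adj G c e))

P5Free : ∀ {n} → Graph n → Set
P5Free {n} G = ∀ (a b c d e : Fin n) → ¬ IsInducedP5 G a b c d e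

-- Suppose b ∈ D. The vertex d is dominated by some x ∈ D. It cannot be d itself,
-- since b and d would then both dominate their common neighbour c; so x is a
-- neighbour of d. Every vertex of N[b] = {a, b, c, …} is already dominated by b,
-- hence not adjacent to x ≠ b. Thus a–b–c–d–x is an induced P5. Reversing the
-- path handles c.
module Submission where

open import Defs
open import Data.Fin using (Fin)
open import Data.Product using (_×_; _,_)
open import Data.Sum using (inj₁; inj₂)
open import Relation.Nullary using (¬_)
open import Relation.Binary.PropositionalEquality using (_≡_; refl; trans; subst)
  renaming (sym to ≡-sym)

module _ {n} (G : Graph n) where

  ¬Adj⇒≢ : ∀ {x y v} → ¬ Adj G y v → Adj G x v → ¬ y ≡ x
  ¬Adj⇒≢ ¬yv xv y≡x = ¬yv (subst (λ z → Adj G z _) (≡-sym y≡x) xv)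

  IsInducedP4-reverse : ∀ {a b c d} → IsInducedP4 G a b c d → IsInducedP4 G d c b a
  IsInducedP4-reverse (a≢b , a≢c , a≢d , b≢c , b≢d , c≢d , ab , bc , cd , ¬ac , ¬ad , ¬bd) =
    ( (λ e → c≢d (≡-sym e)) , (λ e → b≢d (≡-sym e)) , (λ e → a≢d (≡-sym e))
    , (λ e → b≢c (≡-sym e)) , (λ e → a≢c (≡-sym e)) , (λ e → a≢b (≡-sym e))
    , sym G cd , sym G bc , sym G ab
    , (λ A → ¬bd (sym G A)) , (λ A → ¬ad (sym G A)) , (λ A → ¬ac (sym G A)))

module EfficientDomination {n} (G : Graph n) (D : Fin n → Set)
                           (E : IsEfficientDominatingSet G D) where

  dominator-unique : ∀ {v x y} → D x → Dominates G x v → D y → Dominates G y v → x ≡ y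
  dominator-unique {v} Dx xv Dy yv with E v
  ... | _ , _ , unique = trans (unique _ Dx xv) (≡-sym (unique _ Dy yv))

  independent : ∀ {x y} → D x → D y → ¬ Adj G x y
  independent Dx Dy xy =
    irrefl G (subst (λ z → Adj G z _) (dominator-unique Dx (inj₂ xy) Dy (inj₁ refl)) xy)

  P5Free⇒P4-second∉ : P5Free G → ∀ {a b c d} → IsInducedP4 G a b c d → ¬ D b
  P5Free⇒P4-second∉ p5 {a} {b} {c} {d}
                    (a≢b , a≢c , a≢d , b≢c , b≢d , c≢d , ab , bc , cd , ¬ac , ¬ad , ¬bd) Db
    with E d
  ... | x , (Dx , inj₁ x≡d) , _ =
        b≢d (dominator-unique Db (inj₂ bc) (subst D x≡d Dx) (inj₂ (sym G cd)))
  ... | x , (Dx , inj₂ xd) , _ = p5 a b c d x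
        ( (a≢b , a≢c , a≢d , ¬Adj⇒≢ G ¬ad xd , b≢c , b≢d , b≢x , c≢d , c≢x , ¬Adj⇒≢ G (irrefl G) xd)
        , (ab , bc , cd , sym G xd)
        , (¬ac , ¬ad , far (inj₂ (sym G ab)) , ¬bd , far (inj₁ refl) , far (inj₂ bc)))
    where
      b≢x : ¬ b ≡ x
      b≢x = ¬Adj⇒≢ G ¬bd xd

      c≢x : ¬ c ≡ x
      c≢x c≡x = independent Db (subst D (≡-sym c≡x) Dx) bc

      far : ∀ {y} → Dominates G b y → ¬ Adj G y x
      far by yx = b≢x (dominator-unique Db by Dx (inj₂ (sym G yx)))

proposition1 : ∀ {n} (G : Graph n) → P5Free G →
    ∀ (a b c d : Fin n) → IsInducedP4 G a b c d →
    ∀ (D : Fin n → Set) → IsEfficientDominatingSet G D →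
    (¬ D b) × (¬ D c)
proposition1 G p5 a b c d P D E =
  P5Free⇒P4-second∉ p5 P , P5Free⇒P4-second∉ p5 (IsInducedP4-reverse G P)
  where open EfficientDomination G D E
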